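{- Let $m\ge 3$ be odd, $k=\frac{1}{2}(m-1)$, and let $G$ be a multicycle on $m$ vertices with minimum edge multiplicity $\mu^-$. Then $$\chi'(G)\le \chi'(C_{m,\mu^- })+\Delta(G)-2\mu^- = \Delta(G)+\left\lceil \frac{\mu^- }{k}\right\rceil .$$
   Context: A multicycle on $m$ vertices is a multigraph on vertices $v_1,\dots,v_m$ all of whose edges join $v_i$ and $v_{i+1}$ for some $i$ (indices mod $m$), parallel edges allowed; the multiplicity of the pair $\{v_i,v_{i+1}\}$ is the number of edges joining them, and $\mu^-$ is the minimum of these $m$ multiplicities. $C_{m,a}$ denotes the multicycle in which every one of the $m$ pairs has multiplicity exactly $a$. $\Delta(G)$ is the maximum degree (counting parallel edges) and $\chi'$ the edge-chromatic number. -}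

module Defs where

open import Data.Nat using (ℕ; zero; suc; _+_; _*_; _∸_; _⊔_; _⊓_; _≤_; _/_)
open import Data.Nat.DivMod using (_mod_)
open import Data.Fin using (Fin; toℕ)
open import Data.List using (List; []; _∷_; map; foldr)
open import Data.List using (allFin) public
open import Data.Product using (_×_)
open import Relation.Binary.PropositionalEquality using (_≡_; _≢_)

-- A multicycle on m vertices v_0,…,v_{m-1} (m ≥ 3) is given by its multiplicity
-- function: mult i = number of parallel edges joining v_i and v_{i+1} (indices mod m).
Multicycle : ℕ → Set
Multicycle m = Fin m → ℕ

next : ∀ {m} → Fin m → Fin m
next {suc n} i = suc (toℕ i) mod suc n

C : (m a : ℕ) → Multicycle m
C m a _ = a

-- minimum of a list (0 on the empty list; never used for m ≥ 3)
minList : List ℕ → ℕ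
minList []           = 0
minList (x ∷ [])     = x
minList (x ∷ y ∷ xs) = x ⊓ minList (y ∷ xs)

maxList : List ℕ → ℕ
maxList = foldr _⊔_ 0

μ⁻ : ∀ {m} → Multicycle m → ℕ
μ⁻ {m} G = minList (map G (allFin m))

-- Δ: maximum degree; the degree of v_{i+1} is G i + G (next i)
Δ : ∀ {m} → Multicycle m → ℕ
Δ {m} G = maxList (map (λ i → G i + G (next i)) (allFin m))

-- Edges of G: pairs (i , j) with j < G i, the j-th parallel edge between v_i, v_{i+1}.
record ProperColouring {m} (G : Multicycle m) (c : ℕ) : Set where
  field
    colour   : (i : Fin m) → Fin (G i) → Fin c
    parallel : ∀ i (j j' : Fin (G i)) → colour i j ≡ colour i j' → j ≡ j'
    adjacent : ∀ i (j : Fin (G i)) (j' : Fin (G (next i))) → colour i j ≢ colour (next i) j'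

Colourable : ∀ {m} → Multicycle m → ℕ → Set
Colourable G c = ProperColouring G c

IsChromaticIndex : ∀ {m} → Multicycle m → ℕ → Set
IsChromaticIndex G χ = Colourable G χ × (∀ c → Colourable G c → χ ≤ c)

⌈_/_⌉ : ℕ → ℕ → ℕ
⌈ a / zero ⌉  = 0
⌈ a / suc b ⌉ = (a + b) / suc b

module Submission where

-- C_{m,μ⁻} sits inside G, and the excess G i ∸ μ⁻ has an empty pair, so it is a
-- union of paths and can be coloured with its maximum degree, at most Δ(G) − 2μ⁻,
-- in fresh colours. For m = 2k + 1 the chromatic index of C_{m,a} is 2a + ⌈a/k⌉:
-- every colour class is a matching of the odd cycle, so has at most k edges, and
-- conversely pair p can be given a cyclic block of a colours modulo 2a + ⌈a/k⌉,
-- consecutive blocks being separated by gaps of at most ⌈a/k⌉ colours.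

open import Defs
open import Function using (_∘_)
open import Data.Nat
open import Data.Nat.Properties
open import Data.Nat.DivMod
open import Data.Parity.Base using (Parity; 0ℙ; 1ℙ)
open import Data.Parity.Properties using (p≢p⁻¹; suc-homo-⁻¹)
open import Data.Nat.Tactic.RingSolver using (solve-∀)
open import Data.Fin as Fin using (Fin; toℕ; fromℕ<; combine; remQuot)
open import Data.Fin.Properties
  using (toℕ-fromℕ<; toℕ<n; toℕ-injective; any?; combine-injective; combine-remQuot; injective⇒≤)
open import Data.List using ([]; _∷_; map; tabulate)
open import Data.List.Membership.Propositional using (_∈_)
open import Data.List.Membership.Propositional.Properties using (∈-allFin; ∈-map⁺; ∈-map⁻)
open import Data.List.Relation.Unary.Any using (here; there)
open import Data.Product using (∃; _×_; _,_; proj₁; proj₂; uncurry)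
open import Data.Sum using (_⊎_; inj₁; inj₂)
open import Relation.Binary.Definitions using (tri<; tri≈; tri>)
open import Relation.Nullary using (¬_; yes; no; contradiction)
open import Relation.Unary using (Decidable)
open import Relation.Binary.PropositionalEquality

toℕ-next : ∀ {m} (i : Fin m) →
  (suc (toℕ i) < m × toℕ (next i) ≡ suc (toℕ i)) ⊎ (suc (toℕ i) ≡ m × toℕ (next i) ≡ 0)
toℕ-next {suc n} i with m≤n⇒m<n∨m≡n (toℕ<n i)
... | inj₁ lt = inj₁ (lt , trans (toℕ-fromℕ< _) (m<n⇒m%n≡m lt))
... | inj₂ eq = inj₂ (eq , trans (toℕ-fromℕ< _) (trans (cong (_% suc n) eq) (n%n≡0 (suc n))))

next-mod : ∀ {n} p → next (p mod suc n) ≡ suc p mod suc n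
next-mod {n} p = toℕ-injective (begin
  toℕ (next (p mod suc n))                ≡⟨ toℕ-fromℕ< _ ⟩
  suc (toℕ (p mod suc n)) % suc n         ≡⟨ cong (λ r → suc r % suc n) (toℕ-fromℕ< _) ⟩
  (1 + p % suc n) % suc n                 ≡⟨ %-distribˡ-+ 1 (p % suc n) (suc n) ⟩
  (1 % suc n + p % suc n % suc n) % suc n ≡⟨ cong (λ r → (1 % suc n + r) % suc n) (m%n%n≡m%n p (suc n)) ⟩
  (1 % suc n + p % suc n) % suc n         ≡⟨ %-distribˡ-+ 1 p (suc n) ⟨
  suc p % suc n                           ≡⟨ toℕ-fromℕ< _ ⟨
  toℕ (suc p mod suc n)                   ∎)
  where open ≡-Reasoning

[1+n]mod[1+n]≡0 : ∀ n → suc n mod suc n ≡ Fin.zero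
[1+n]mod[1+n]≡0 n = toℕ-injective (trans (toℕ-fromℕ< _) (n%n≡0 (suc n)))

toℕ-mod : ∀ {n} (i : Fin (suc n)) → toℕ i mod suc n ≡ i
toℕ-mod i = toℕ-injective (trans (toℕ-fromℕ< _) (m<n⇒m%n≡m (toℕ<n i)))

minList-≤ : ∀ {x} xs → x ∈ xs → minList xs ≤ x
minList-≤ (x ∷ [])     (here refl) = ≤-refl
minList-≤ (x ∷ y ∷ xs) (here refl) = m⊓n≤m x _
minList-≤ (x ∷ y ∷ xs) (there x∈) = ≤-trans (m⊓n≤n x _) (minList-≤ (y ∷ xs) x∈)

minList-∈ : ∀ x xs → minList (x ∷ xs) ∈ x ∷ xs
minList-∈ x []       = here refl
minList-∈ x (y ∷ xs) with ⊓-sel x (minList (y ∷ xs))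
... | inj₁ eq = here eq
... | inj₂ eq = there (subst (_∈ y ∷ xs) (sym eq) (minList-∈ y xs))

maxList-≥ : ∀ {x} xs → x ∈ xs → x ≤ maxList xs
maxList-≥ (x ∷ xs) (here refl) = m≤m⊔n x _
maxList-≥ (y ∷ xs) (there x∈) = ≤-trans (maxList-≥ xs x∈) (m≤n⊔m y _)

μ⁻-≤ : ∀ {m} (G : Multicycle m) i → μ⁻ G ≤ G i
μ⁻-≤ {m} G i = minList-≤ (map G (allFin m)) (∈-map⁺ G (∈-allFin i))

μ⁻-attained : ∀ {n} (G : Multicycle (suc n)) → ∃ λ p → G p ≡ μ⁻ G
μ⁻-attained {n} G with ∈-map⁻ G (minList-∈ (G Fin.zero) (map G (tabulate {n = n} Fin.suc)))
... | p , _ , eq = p , sym eq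

Δ-≥ : ∀ {m} (G : Multicycle m) i → G i + G (next i) ≤ Δ G
Δ-≥ {m} G i = maxList-≥ _ (∈-map⁺ (λ i → G i + G (next i)) (∈-allFin i))

2μ⁻≤Δ : ∀ {n} (G : Multicycle (suc n)) → 2 * μ⁻ G ≤ Δ G
2μ⁻≤Δ G = ≤-trans (+-mono-≤ (μ⁻-≤ G Fin.zero) μ⁻+0≤) (Δ-≥ G Fin.zero)
  where
    μ⁻+0≤ : μ⁻ G + 0 ≤ G (next Fin.zero)
    μ⁻+0≤ = subst (_≤ G (next Fin.zero)) (sym (+-identityʳ _)) (μ⁻-≤ G _)

x%n≡y%n⇒x∸y≡[x/n∸y/n]*n : ∀ {x y} n .{{_ : NonZero n}} →
                           x % n ≡ y % n → x ∸ y ≡ (x / n ∸ y / n) * n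
x%n≡y%n⇒x∸y≡[x/n∸y/n]*n {x} {y} n eq = begin
  x ∸ y                                     ≡⟨ cong₂ _∸_ (m≡m%n+[m/n]*n x n) (m≡m%n+[m/n]*n y n) ⟩
  (x % n + x / n * n) ∸ (y % n + y / n * n) ≡⟨ cong (λ r → (r + x / n * n) ∸ (y % n + y / n * n)) eq ⟩
  (y % n + x / n * n) ∸ (y % n + y / n * n) ≡⟨ [m+n]∸[m+o]≡n∸o (y % n) _ _ ⟩
  x / n * n ∸ y / n * n                     ≡⟨ *-distribʳ-∸ n (x / n) (y / n) ⟨
  (x / n ∸ y / n) * n                       ∎
  where open ≡-Reasoning

+-cancelˡ-% : ∀ x {j j' n} .{{_ : NonZero n}} → j < n → j' < n →
              (x + j) % n ≡ (x + j') % n → j ≡ j'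
+-cancelˡ-% x j<n j'<n eq = ≤-antisym (difference-zero j<n eq) (difference-zero j'<n (sym eq))
  where
    multiple<n⇒0 : ∀ q {n} → q * n < n → q * n ≡ 0
    multiple<n⇒0 zero    _  = refl
    multiple<n⇒0 (suc q) lt = contradiction lt (≤⇒≯ (m≤m+n _ (q * _)))
    difference-zero : ∀ {j j' n} .{{_ : NonZero n}} → j < n → (x + j) % n ≡ (x + j') % n → j ≤ j'
    difference-zero {j} {j'} {n} j<n eq = m∸n≡0⇒m≤n (trans j∸j'≡qn (multiple<n⇒0 q qn<n))
      where
        q = (x + j) / n ∸ (x + j') / n
        j∸j'≡qn : j ∸ j' ≡ q * n
        j∸j'≡qn = trans (sym ([m+n]∸[m+o]≡n∸o x j j')) (x%n≡y%n⇒x∸y≡[x/n∸y/n]*n n eq)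
        qn<n : q * n < n
        qn<n = ≤-<-trans (≤-trans (≤-reflexive (sym j∸j'≡qn)) (m∸n≤m j j')) j<n

x%n≡y%n⇒[x+j]%n≡[y+j]%n : ∀ {x y} j {n} .{{_ : NonZero n}} →
                           x % n ≡ y % n → (x + j) % n ≡ (y + j) % n
x%n≡y%n⇒[x+j]%n≡[y+j]%n {x} {y} j {n} eq = begin
  (x + j) % n           ≡⟨ %-distribˡ-+ x j n ⟩
  (x % n + j % n) % n   ≡⟨ cong (λ r → (r + j % n) % n) eq ⟩
  (y % n + j % n) % n   ≡⟨ %-distribˡ-+ y j n ⟨
  (y + j) % n           ∎
  where open ≡-Reasoning

≤-⌈/⌉* : ∀ a k' → a ≤ ⌈ a / suc k' ⌉ * suc k'
≤-⌈/⌉* a k' = +-cancelʳ-≤ k' a (q * suc k') (begin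
  a + k'                         ≡⟨ m≡m%n+[m/n]*n (a + k') (suc k') ⟩
  (a + k') % suc k' + q * suc k' ≤⟨ +-monoˡ-≤ _ (s≤s⁻¹ (m%n<n (a + k') (suc k'))) ⟩
  k' + q * suc k'                ≡⟨ +-comm k' _ ⟩
  q * suc k' + k'                ∎)
  where
    open ≤-Reasoning
    q = ⌈ a / suc k' ⌉

⌈/⌉-least : ∀ a k' {d} → a ≤ d * suc k' → ⌈ a / suc k' ⌉ ≤ d
⌈/⌉-least a k' {d} a≤dk = s≤s⁻¹ (m<n*o⇒m/o<n (begin-strict
  a + k'              <⟨ +-monoʳ-< a ≤-refl ⟩
  a + suc k'          ≤⟨ +-monoˡ-≤ (suc k') a≤dk ⟩
  d * suc k' + suc k' ≡⟨ +-comm _ (suc k') ⟩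
  suc d * suc k'      ∎))
  where open ≤-Reasoning

⊓-step : ∀ x t D → ∃ λ u → u ≤ t × (t + x) ⊓ D ≡ x ⊓ D + u
⊓-step x t D with ≤-total x D
... | inj₂ D≤x = 0 , z≤n , trans (m≥n⇒m⊓n≡n (≤-trans D≤x (m≤n+m x t)))
                                 (sym (trans (+-identityʳ _) (m≥n⇒m⊓n≡n D≤x)))
... | inj₁ x≤D with ≤-total (t + x) D
...   | inj₁ t+x≤D = t , ≤-refl ,
          trans (m≤n⇒m⊓n≡m t+x≤D) (trans (+-comm t x) (cong (_+ t) (sym (m≤n⇒m⊓n≡m x≤D))))
...   | inj₂ D≤t+x = D ∸ x , ≤-trans (∸-monoˡ-≤ x D≤t+x) (≤-reflexive (m+n∸n≡m t x)) ,
          trans (m≥n⇒m⊓n≡n D≤t+x)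
                (trans (sym (m+[n∸m]≡n x≤D)) (cong (_+ (D ∸ x)) (sym (m≤n⇒m⊓n≡m x≤D))))

⌊n/2⌋*2-or-suc : ∀ n → n ≡ ⌊ n /2⌋ * 2 ⊎ n ≡ suc (⌊ n /2⌋ * 2)
⌊n/2⌋*2-or-suc zero          = inj₁ refl
⌊n/2⌋*2-or-suc (suc zero)    = inj₂ refl
⌊n/2⌋*2-or-suc (suc (suc n)) with ⌊n/2⌋*2-or-suc n
... | inj₁ eq = inj₁ (cong (suc ∘ suc) eq)
... | inj₂ eq = inj₂ (cong (suc ∘ suc) eq)

⌊n/2⌋<k : ∀ {n k} → n < k * 2 → ⌊ n /2⌋ < k
⌊n/2⌋<k {n} {k} n<2k = *-cancelʳ-< 2 _ k (≤-<-trans ⌊n/2⌋*2≤n n<2k)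
  where
    ⌊n/2⌋*2≤n : ⌊ n /2⌋ * 2 ≤ n
    ⌊n/2⌋*2≤n with ⌊n/2⌋*2-or-suc n
    ... | inj₁ eq = ≤-reflexive (sym eq)
    ... | inj₂ eq = ≤-trans (n≤1+n _) (≤-reflexive (sym eq))

parity-suc : ∀ n → parity n ≢ parity (suc n)
parity-suc n eq = p≢p⁻¹ (parity (suc n)) (sym (trans (suc-homo-⁻¹ n) eq))

free-window : ∀ {ℓ} {U : ℕ → Set ℓ} → Decidable U → (∀ p → U p → ¬ U (suc p)) →
              ∀ k' → ¬ U 0 → ¬ U (suc (k' * 2)) →
              ∃ λ s → s ≤ k' × ¬ U (s * 2) × ¬ U (suc (s * 2))
free-window U? apart k' ¬U₀ ¬Uₑ with U? 1
... | no ¬U₁ = 0 , z≤n , ¬U₀ , ¬U₁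
free-window U? apart zero     ¬U₀ ¬Uₑ | yes U₁ = contradiction U₁ ¬Uₑ
free-window U? apart (suc k') ¬U₀ ¬Uₑ | yes U₁
  with free-window (U? ∘ (2 +_)) (apart ∘ (2 +_)) k' (apart 1 U₁) ¬Uₑ
... | s , s≤k' , ¬U₂ₛ , ¬U₂ₛ₊₁ = suc s , s≤s s≤k' , ¬U₂ₛ , ¬U₂ₛ₊₁

×-injective⇒≤ : ∀ {a b c d} (f : Fin a × Fin b → Fin c × Fin d) →
                (∀ u v → f u ≡ f v → u ≡ v) → a * b ≤ c * d
×-injective⇒≤ {a} {b} {c} {d} f f-injective = injective⇒≤ g-injective
  where
    g : Fin (a * b) → Fin (c * d)
    g = uncurry combine ∘ f ∘ remQuot {a} b
    g-injective : ∀ {z z'} → g z ≡ g z' → z ≡ z'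
    g-injective {z} {z'} eq = begin
      z                                  ≡⟨ combine-remQuot {a} b z ⟨
      uncurry combine (remQuot {a} b z)  ≡⟨ cong (uncurry combine) (f-injective _ _ f≡) ⟩
      uncurry combine (remQuot {a} b z') ≡⟨ combine-remQuot {a} b z' ⟩
      z'                                 ∎
      where
        open ≡-Reasoning
        ×-≡ : ∀ {x y : Fin c × Fin d} → proj₁ x ≡ proj₁ y × proj₂ x ≡ proj₂ y → x ≡ y
        ×-≡ (refl , refl) = refl
        f≡ : f (remQuot {a} b z) ≡ f (remQuot {a} b z')
        f≡ = ×-≡ (combine-injective _ _ _ _ eq)

record ℕColouring {m} (G : Multicycle m) (c : ℕ) : Set where
  field
    colour   : Fin m → ℕ → ℕ
    colour-< : ∀ i j → j < G i → colour i j < c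
    parallel : ∀ i j j' → j < G i → j' < G i → colour i j ≡ colour i j' → j ≡ j'
    adjacent : ∀ i j j' → j < G i → j' < G (next i) → colour i j ≢ colour (next i) j'

fromℕColouring : ∀ {m} {G : Multicycle m} {c} → ℕColouring G c → ProperColouring G c
fromℕColouring P = record
  { colour   = λ i j → fromℕ< (colour-< i (toℕ j) (toℕ<n j))
  ; parallel = λ i j j' eq → toℕ-injective (parallel i _ _ (toℕ<n j) (toℕ<n j') (toℕ-cong eq))
  ; adjacent = λ i j j' eq → adjacent i _ _ (toℕ<n j) (toℕ<n j') (toℕ-cong eq)
  }
  where
    open ℕColouring P
    toℕ-cong : ∀ {c x y} .{p : x < c} .{q : y < c} → fromℕ< p ≡ fromℕ< q → x ≡ y
    toℕ-cong {p = p} {q} eq = trans (sym (toℕ-fromℕ< p)) (trans (cong toℕ eq) (toℕ-fromℕ< q))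

module _ {m} {G : Multicycle m} {c} (P : ProperColouring G c) where
  open ProperColouring P

  colourℕ : Fin m → ℕ → ℕ
  colourℕ i j with j <? G i
  ... | yes j< = toℕ (colour i (fromℕ< j<))
  ... | no _   = 0

  colourℕ-≡ : ∀ i {j} (j< : j < G i) → colourℕ i j ≡ toℕ (colour i (fromℕ< j<))
  colourℕ-≡ i {j} j< with j <? G i
  ... | yes _  = refl
  ... | no j≮ = contradiction j< j≮

  toℕColouring : ℕColouring G c
  toℕColouring = record
    { colour   = colourℕ
    ; colour-< = λ i j j< → subst (_< c) (sym (colourℕ-≡ i j<)) (toℕ<n _)
    ; parallel = λ i j j' j< j'< eq →
        trans (sym (toℕ-fromℕ< j<)) (trans (cong toℕ (parallel i _ _ (toℕ-injective
          (trans (sym (colourℕ-≡ i j<)) (trans eq (colourℕ-≡ i j'<)))))) (toℕ-fromℕ< j'<))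
    ; adjacent = λ i j j' j< j'< eq → adjacent i _ _ (toℕ-injective
        (trans (sym (colourℕ-≡ i j<)) (trans eq (colourℕ-≡ (next i) j'<))))
    }

superpose : ∀ {m} {G A B : Multicycle m} {c d} → (∀ i → G i ≡ A i + B i) →
            ℕColouring A c → ℕColouring B d → ℕColouring G (c + d)
superpose {m} {G} {A} {B} {c} {d} split PA PB = record
  { colour   = colour
  ; colour-< = colour-<
  ; parallel = parallel
  ; adjacent = adjacent
  }
  where
    module A = ℕColouring PA
    module B = ℕColouring PB

    colour : Fin m → ℕ → ℕ
    colour i j with j <? A i
    ... | yes _ = A.colour i j
    ... | no  _ = c + B.colour i (j ∸ A i)

    excess-< : ∀ i {j} → j < G i → ¬ j < A i → j ∸ A i < B i
    excess-< i {j} j<G j≮A = subst (j ∸ A i <_) (trans (cong (_∸ A i) (split i)) (m+n∸m≡n (A i) (B i)))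
                                   (∸-monoˡ-< j<G (≮⇒≥ j≮A))

    below≢above : ∀ {x} y → x < c → x ≢ c + y
    below≢above y x<c refl = m+n≮m c y x<c

    colour-< : ∀ i j → j < G i → colour i j < c + d
    colour-< i j j<G with j <? A i
    ... | yes j<A = <-≤-trans (A.colour-< i j j<A) (m≤m+n c d)
    ... | no  j≮A = +-monoʳ-< c (B.colour-< i _ (excess-< i j<G j≮A))

    parallel : ∀ i j j' → j < G i → j' < G i → colour i j ≡ colour i j' → j ≡ j'
    parallel i j j' j<G j'<G eq with j <? A i | j' <? A i
    ... | yes j<A | yes j'<A = A.parallel i j j' j<A j'<A eq
    ... | yes j<A | no  _    = contradiction eq (below≢above _ (A.colour-< i j j<A))
    ... | no  _   | yes j'<A = contradiction (sym eq) (below≢above _ (A.colour-< i j' j'<A))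
    ... | no  j≮A | no  j'≮A = ∸-cancelʳ-≡ (≮⇒≥ j≮A) (≮⇒≥ j'≮A)
      (B.parallel i _ _ (excess-< i j<G j≮A) (excess-< i j'<G j'≮A) (+-cancelˡ-≡ c _ _ eq))

    adjacent : ∀ i j j' → j < G i → j' < G (next i) → colour i j ≢ colour (next i) j'
    adjacent i j j' j<G j'<G eq with j <? A i | j' <? A (next i)
    ... | yes j<A | yes j'<A = A.adjacent i j j' j<A j'<A eq
    ... | yes j<A | no  _    = below≢above _ (A.colour-< i j j<A) eq
    ... | no  _   | yes j'<A = below≢above _ (A.colour-< (next i) j' j'<A) (sym eq)
    ... | no  j≮A | no  j'≮A =
      B.adjacent i _ _ (excess-< i j<G j≮A) (excess-< (next i) j'<G j'≮A) (+-cancelˡ-≡ c _ _ eq)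

-- The chromatic index of C_{2k+1,a}, where k = suc k'

cyclic-colouring : ∀ {m} a n .{{_ : NonZero n}} (start : Fin m → ℕ) →
  (∀ i → ∃ λ s → a + s + a ≤ n × start (next i) % n ≡ (start i + (a + s)) % n) →
  ℕColouring (C m a) n
cyclic-colouring a n start step = record
  { colour   = λ i j → (start i + j) % n
  ; colour-< = λ i j _ → m%n<n _ n
  ; parallel = λ i j j' j<a j'<a → +-cancelˡ-% (start i) (<n i j<a) (<n i j'<a)
  ; adjacent = adjacent
  }
  where
    <n : ∀ i {j} → j < a → j < n
    <n i j<a with step i
    ... | s , a+s+a≤n , _ = <-≤-trans j<a (≤-trans (m≤n+m a (a + s)) a+s+a≤n)

    adjacent : ∀ i j j' → j < a → j' < a → (start i + j) % n ≢ (start (next i) + j') % n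
    adjacent i j j' j<a j'<a eq with step i
    ... | s , a+s+a≤n , shift = <⇒≢ (≤-trans j<a (≤-trans (m≤m+n a s) (m≤m+n (a + s) j')))
      (+-cancelˡ-% (start i) (<n i j<a) (<-≤-trans (+-monoʳ-< (a + s) j'<a) a+s+a≤n) (begin
        (start i + j) % n            ≡⟨ eq ⟩
        (start (next i) + j') % n    ≡⟨ x%n≡y%n⇒[x+j]%n≡[y+j]%n j' shift ⟩
        (start i + (a + s) + j') % n ≡⟨ cong (_% n) (+-assoc (start i) (a + s) j') ⟩
        (start i + (a + s + j')) % n ∎))
      where open ≡-Reasoning

-- The block of pair p starts at colour start p (mod n). The slack t k − a is handed
-- out one gap of at most t colours at a time, which makes the last block end
-- exactly where block 0 begins (start-wrap).
module BalancedSpread (k' a' : ℕ) where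
  k = suc k'
  a = suc a'
  t = ⌈ a / k ⌉
  n = 2 * a + t
  slack = t * k ∸ a

  start : ℕ → ℕ
  start p = p * a + p * t ⊓ slack

  start-suc : ∀ p → ∃ λ u → u ≤ t × start (suc p) ≡ start p + (a + u)
  start-suc p with ⊓-step (p * t) t slack
  ... | u , u≤t , eq = u , u≤t , (begin
    (a + p * a) + (t + p * t) ⊓ slack   ≡⟨ cong ((a + p * a) +_) eq ⟩
    (a + p * a) + (p * t ⊓ slack + u)   ≡⟨ rearrange a (p * a) (p * t ⊓ slack) u ⟩
    p * a + p * t ⊓ slack + (a + u)     ∎)
    where
      open ≡-Reasoning
      rearrange : ∀ a b c u → (a + b) + (c + u) ≡ b + c + (a + u)
      rearrange = solve-∀

  start-wrap : start (k * 2) + a ≡ k * n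
  start-wrap = begin
    (k * 2) * a + (k * 2) * t ⊓ slack + a ≡⟨ cong (λ z → (k * 2) * a + z + a) (m≥n⇒m⊓n≡n slack≤) ⟩
    (k * 2) * a + slack + a               ≡⟨ +-assoc ((k * 2) * a) slack a ⟩
    (k * 2) * a + (slack + a)             ≡⟨ cong ((k * 2) * a +_) (m∸n+n≡m (≤-⌈/⌉* a k')) ⟩
    (k * 2) * a + t * k                   ≡⟨ regroup k a t ⟩
    k * n                                 ∎
    where
      open ≡-Reasoning
      slack≤ : slack ≤ (k * 2) * t
      slack≤ = ≤-trans (m∸n≤m (t * k) a) (≤-trans (m≤m+n (t * k) (t * k)) (≤-reflexive (double t k)))
        where
          double : ∀ t k → t * k + t * k ≡ k * 2 * t
          double = solve-∀
      regroup : ∀ k a t → (k * 2) * a + t * k ≡ k * (2 * a + t)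
      regroup = solve-∀

  gap≤ : ∀ {u} → u ≤ t → a + u + a ≤ n
  gap≤ {u} u≤t = ≤-trans (+-monoˡ-≤ a (+-monoʳ-≤ a u≤t)) (≤-reflexive (rotate a t))
    where
      rotate : ∀ a t → a + t + a ≡ 2 * a + t
      rotate = solve-∀

  step : (i : Fin (suc (k * 2))) →
         ∃ λ s → a + s + a ≤ n × start (toℕ (next i)) % n ≡ (start (toℕ i) + (a + s)) % n
  step i with toℕ-next i
  ... | inj₁ (_ , next≡) with start-suc (toℕ i)
  ...   | u , u≤t , eq = u , gap≤ u≤t , cong (_% n) (trans (cong start next≡) eq)
  step i | inj₂ (last , next≡0) = 0 , gap≤ z≤n , (begin
    start (toℕ (next i)) % n       ≡⟨ cong (λ p → start p % n) next≡0 ⟩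
    0                              ≡⟨ m*n%n≡0 k n ⟨
    (k * n) % n                    ≡⟨ cong (_% n) start-wrap ⟨
    (start (k * 2) + a) % n        ≡⟨ cong₂ (λ p b → (start p + b) % n) (suc-injective last) (+-identityʳ a) ⟨
    (start (toℕ i) + (a + 0)) % n  ∎)
    where open ≡-Reasoning

  colouring : ℕColouring (C (suc (k * 2)) a) n
  colouring = cyclic-colouring a n (start ∘ toℕ) step

C-colourable : ∀ k' a → Colourable (C (suc (suc k' * 2)) a) (2 * a + ⌈ a / suc k' ⌉)
C-colourable k' zero     = record { colour = λ _ (); parallel = λ _ (); adjacent = λ _ () }
C-colourable k' (suc a') = fromℕColouring (BalancedSpread.colouring k' a')

-- Pairs 2s and 2s+1 share slot s; an edge of the last pair 2k takes a slot whose two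
-- pairs miss its colour. The map edge ↦ (colour, slot) is then injective.
module ColourClasses {k' a c : ℕ} (P : ProperColouring (C (suc (suc k' * 2)) a) c) where
  open ProperColouring P

  k    = suc k'
  last = k * 2
  m    = suc last

  Uses : Fin c → Fin m → Set
  Uses x i = ∃ λ j → colour i j ≡ x

  UsesAt : Fin c → ℕ → Set
  UsesAt x p = Uses x (p mod m)

  Free : Fin c → ℕ → Set
  Free x s = ¬ UsesAt x (s * 2) × ¬ UsesAt x (suc (s * 2))

  usesAt? : ∀ x → Decidable (UsesAt x)
  usesAt? x p = any? (λ j → colour (p mod m) j Fin.≟ x)

  usesAt : ∀ {x i p} → toℕ i ≡ p → Uses x i → UsesAt x p
  usesAt {x} {i} refl = subst (Uses x) (sym (toℕ-mod i))

  uses-next : ∀ {x} i → Uses x i → ¬ Uses x (next i)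
  uses-next i (j , refl) (j' , eq) = adjacent i j j' (sym eq)

  usesAt-apart : ∀ x p → UsesAt x p → ¬ UsesAt x (suc p)
  usesAt-apart x p uses uses' = uses-next (p mod m) uses (subst (Uses x) (sym (next-mod p)) uses')

  free-slot : ∀ {x i} → toℕ i ≡ last → Uses x i → ∃ λ s → s < k × Free x s
  free-slot {x} i≡last uses with free-window (usesAt? x) (usesAt-apart x) k' ¬first ¬penultimate
    where
      usesLast : UsesAt x last
      usesLast = usesAt i≡last uses
      ¬first : ¬ UsesAt x 0
      ¬first uses₀ = usesAt-apart x last usesLast (subst (Uses x) (sym ([1+n]mod[1+n]≡0 last)) uses₀)
      ¬penultimate : ¬ UsesAt x (suc (k' * 2))
      ¬penultimate usesₚ = usesAt-apart x (suc (k' * 2)) usesₚ usesLast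
  ... | s , s≤k' , free = s , s≤s s≤k' , free

  Covers : ℕ → ℕ → Set
  Covers s p = p ≡ s * 2 ⊎ p ≡ suc (s * 2)

  Slot : Fin m → Fin c → ℕ → Set
  Slot i x s = Covers s (toℕ i) ⊎ (toℕ i ≡ last × Free x s)

  ≮last⇒≡last : ∀ i → ¬ toℕ i < last → toℕ i ≡ last
  ≮last⇒≡last i i≮last = ≤-antisym (s≤s⁻¹ (toℕ<n i)) (≮⇒≥ i≮last)

  slot : ∀ i j → ∃ λ s → s < k × Slot i (colour i j) s
  slot i j with toℕ i <? last
  ... | yes i<last = ⌊ toℕ i /2⌋ , ⌊n/2⌋<k i<last , inj₁ (⌊n/2⌋*2-or-suc (toℕ i))
  ... | no i≮last with free-slot (≮last⇒≡last i i≮last) (j , refl)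
  ...   | s , s<k , free = s , s<k , inj₂ (≮last⇒≡last i i≮last , free)

  covered-free : ∀ {x i s} → Covers s (toℕ i) → Uses x i → ¬ Free x s
  covered-free (inj₁ eq) uses (¬uses , _) = ¬uses (usesAt eq uses)
  covered-free (inj₂ eq) uses (_ , ¬uses) = ¬uses (usesAt eq uses)

  covered-twice : ∀ {x i i' s} → Covers s (toℕ i) → Covers s (toℕ i') →
                  Uses x i → Uses x i' → toℕ i ≡ toℕ i'
  covered-twice (inj₁ eq) (inj₁ eq') _ _ = trans eq (sym eq')
  covered-twice (inj₂ eq) (inj₂ eq') _ _ = trans eq (sym eq')
  covered-twice {x} {s = s} (inj₁ eq) (inj₂ eq') uses uses' =
    contradiction (usesAt eq' uses') (usesAt-apart x (s * 2) (usesAt eq uses))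
  covered-twice {x} {s = s} (inj₂ eq) (inj₁ eq') uses uses' =
    contradiction (usesAt eq uses) (usesAt-apart x (s * 2) (usesAt eq' uses'))

  same-pair : ∀ {i i' j j'} → toℕ i ≡ toℕ i' → colour i j ≡ colour i' j' →
              _≡_ {A = Fin m × Fin a} (i , j) (i' , j')
  same-pair {i} {j = j} {j'} i≡i' eq with toℕ-injective i≡i'
  ... | refl = cong (i ,_) (parallel i j j' eq)

  same-slot : ∀ {i i' j j' s} → colour i j ≡ colour i' j' →
              Slot i (colour i j) s → Slot i' (colour i' j') s →
              _≡_ {A = Fin m × Fin a} (i , j) (i' , j')
  same-slot {j = j} {j'} {s} eq (inj₁ cov) (inj₁ cov') =
    same-pair (covered-twice {s = s} cov cov' (j , refl) (j' , sym eq)) eq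
  same-slot {j = j} {s = s} eq (inj₁ cov) (inj₂ (_ , free)) =
    contradiction free (covered-free {s = s} cov (j , eq))
  same-slot {j' = j'} {s} eq (inj₂ (_ , free)) (inj₁ cov) =
    contradiction free (covered-free {s = s} cov (j' , sym eq))
  same-slot eq (inj₂ (last , _)) (inj₂ (last' , _)) = same-pair (trans last (sym last')) eq

  classify : Fin m × Fin a → Fin c × Fin k
  classify (i , j) = colour i j , fromℕ< (proj₁ (proj₂ (slot i j)))

  classify-injective : ∀ u v → classify u ≡ classify v → u ≡ v
  classify-injective (i , j) (i' , j') eq with slot i j | slot i' j' | cong proj₁ eq | cong (toℕ ∘ proj₂) eq
  ... | s , s<k , sl | s' , s'<k , sl' | eq₁ | eq₂ =
    same-slot {s = s} eq₁ sl (subst (Slot i' (colour i' j')) (sym s≡s') sl')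
    where s≡s' = trans (sym (toℕ-fromℕ< s<k)) (trans eq₂ (toℕ-fromℕ< s'<k))

  size-bound : m * a ≤ c * k
  size-bound = ×-injective⇒≤ classify classify-injective

matching-bound⇒χ'-bound : ∀ k' a c → suc (suc k' * 2) * a ≤ c * suc k' →
                          2 * a + ⌈ a / suc k' ⌉ ≤ c
matching-bound⇒χ'-bound k' a c bound = begin
  2 * a + ⌈ a / k ⌉ ≤⟨ +-monoʳ-≤ (2 * a) (⌈/⌉-least a k' a≤dk) ⟩
  2 * a + d         ≡⟨ m+[n∸m]≡n 2a≤c ⟩
  c                 ∎
  where
    open ≤-Reasoning
    k = suc k'
    d = c ∸ 2 * a
    regroup : ∀ k a → suc (k * 2) * a ≡ 2 * a * k + a
    regroup = solve-∀
    2a≤c : 2 * a ≤ c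
    2a≤c = *-cancelʳ-≤ (2 * a) c k (≤-trans (m≤m+n _ a) (≤-trans (≤-reflexive (sym (regroup k a))) bound))
    a≤dk : a ≤ d * k
    a≤dk = +-cancelˡ-≤ (2 * a * k) a (d * k) (begin
      2 * a * k + a       ≡⟨ regroup k a ⟨
      suc (k * 2) * a     ≤⟨ bound ⟩
      c * k               ≡⟨ cong (_* k) (m+[n∸m]≡n 2a≤c) ⟨
      (2 * a + d) * k     ≡⟨ *-distribʳ-+ k (2 * a) d ⟩
      2 * a * k + d * k   ∎)

χ'-C : ∀ k' {a χ} → IsChromaticIndex (C (suc (suc k' * 2)) a) χ → χ ≡ 2 * a + ⌈ a / suc k' ⌉
χ'-C k' {a} {χ} (colourable , least) = ≤-antisym
  (least _ (C-colourable k' a))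
  (matching-bound⇒χ'-bound k' a χ (ColourClasses.size-bound colourable))

-- Colouring the excess over C_{m,μ⁻}

fromSide : ℕ → Parity → ℕ → ℕ
fromSide D 0ℙ u = u
fromSide D 1ℙ u = D ∸ suc u

fromSide-< : ∀ D side {u} → u < D → fromSide D side u < D
fromSide-< D       0ℙ     u<D = u<D
fromSide-< (suc D) 1ℙ {u} _ = s≤s (m∸n≤m D u)

fromSide-injective : ∀ D side {u u'} → u < D → u' < D →
                     fromSide D side u ≡ fromSide D side u' → u ≡ u'
fromSide-injective D 0ℙ _   _    eq = eq
fromSide-injective D 1ℙ u<D u'<D eq = suc-injective (∸-cancelˡ-≡ u<D u'<D eq)

bottom≢top : ∀ {A B D u u'} → u < A → u' < B → A + B ≤ D → u ≢ D ∸ suc u'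
bottom≢top {A} {B} {D} {u} {u'} u<A u'<B A+B≤D eq = <-irrefl sum≡D sum<D
  where
    sum<D : u + suc u' < D
    sum<D = <-≤-trans (+-monoˡ-< (suc u') u<A) (≤-trans (+-monoʳ-≤ A u'<B) A+B≤D)
    sum≡D : u + suc u' ≡ D
    sum≡D = trans (cong (_+ suc u') eq) (m∸n+n≡m (≤-trans u'<B (≤-trans (m≤n+m B A) A+B≤D)))

fromSide-apart : ∀ {A B D u u'} side side' → side ≢ side' → u < A → u' < B → A + B ≤ D →
                 fromSide D side u ≢ fromSide D side' u'
fromSide-apart 0ℙ 0ℙ sides _ _ _ = contradiction refl sides
fromSide-apart 1ℙ 1ℙ sides _ _ _ = contradiction refl sides
fromSide-apart 0ℙ 1ℙ _ u<A u'<B A+B≤D = bottom≢top u<A u'<B A+B≤D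
fromSide-apart {A} {B} 1ℙ 0ℙ _ u<A u'<B A+B≤D =
  bottom≢top u'<B u<A (≤-trans (≤-reflexive (+-comm B A)) A+B≤D) ∘ sym

module PathColouring {m} (H : Multicycle m) (p : Fin m) (H[p]≡0 : H p ≡ 0)
                     (D : ℕ) (H-bound : ∀ i → H i + H (next i) ≤ D) where
  -- position of pair i on the path that starts just after the empty pair p
  pos : Fin m → ℕ
  pos i with toℕ p <? toℕ i
  ... | yes _ = toℕ i ∸ suc (toℕ p)
  ... | no  _ = toℕ i + m ∸ suc (toℕ p)

  pos-after : ∀ i → toℕ p < toℕ i → pos i ≡ toℕ i ∸ suc (toℕ p)
  pos-after i p<i with toℕ p <? toℕ i
  ... | yes _   = refl
  ... | no  p≮i = contradiction p<i p≮i

  pos-before : ∀ i → ¬ toℕ p < toℕ i → pos i ≡ toℕ i + m ∸ suc (toℕ p)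
  pos-before i p≮i with toℕ p <? toℕ i
  ... | yes p<i = contradiction p<i p≮i
  ... | no  _   = refl

  pos-next : ∀ i → toℕ i ≢ toℕ p → pos (next i) ≡ suc (pos i)
  pos-next i i≢p with toℕ-next i
  ... | inj₁ (_ , next≡) with <-cmp (toℕ p) (toℕ i)
  ...   | tri≈ _ p≡i _ = contradiction (sym p≡i) i≢p
  ...   | tri< p<i _ _ = begin
    pos (next i)                  ≡⟨ pos-after (next i) (subst (toℕ p <_) (sym next≡) (m<n⇒m<1+n p<i)) ⟩
    toℕ (next i) ∸ suc (toℕ p)    ≡⟨ cong (_∸ suc (toℕ p)) next≡ ⟩
    suc (toℕ i) ∸ suc (toℕ p)     ≡⟨ +-∸-assoc 1 p<i ⟩
    suc (toℕ i ∸ suc (toℕ p))     ≡⟨ cong suc (pos-after i p<i) ⟨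
    suc (pos i)                   ∎
    where open ≡-Reasoning
  ...   | tri> _ _ i<p = begin
    pos (next i)                   ≡⟨ pos-before (next i) p≮next ⟩
    toℕ (next i) + m ∸ suc (toℕ p) ≡⟨ cong (λ x → x + m ∸ suc (toℕ p)) next≡ ⟩
    suc (toℕ i) + m ∸ suc (toℕ p)  ≡⟨ +-∸-assoc 1 (≤-trans (toℕ<n p) (m≤n+m m (toℕ i))) ⟩
    suc (toℕ i + m ∸ suc (toℕ p))  ≡⟨ cong suc (pos-before i (<⇒≯ i<p)) ⟨
    suc (pos i)                    ∎
    where
      open ≡-Reasoning
      p≮next : ¬ toℕ p < toℕ (next i)
      p≮next p<next = <⇒≱ i<p (s≤s⁻¹ (subst (toℕ p <_) next≡ p<next))
  pos-next i i≢p | inj₂ (wrap , next≡0) = begin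
    pos (next i)                   ≡⟨ pos-before (next i) (subst (λ x → ¬ toℕ p < x) (sym next≡0) λ ()) ⟩
    toℕ (next i) + m ∸ suc (toℕ p) ≡⟨ cong (λ x → x + m ∸ suc (toℕ p)) next≡0 ⟩
    m ∸ suc (toℕ p)                ≡⟨ cong (_∸ suc (toℕ p)) wrap ⟨
    suc (toℕ i) ∸ suc (toℕ p)      ≡⟨ +-∸-assoc 1 p<i ⟩
    suc (toℕ i ∸ suc (toℕ p))      ≡⟨ cong suc (pos-after i p<i) ⟨
    suc (pos i)                    ∎
    where
      open ≡-Reasoning
      p<i : toℕ p < toℕ i
      p<i = ≤∧≢⇒< (s≤s⁻¹ (subst (toℕ p <_) (sym wrap) (toℕ<n p))) (i≢p ∘ sym)

  side : Fin m → Parity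
  side i = parity (pos i)

  occupied≢p : ∀ i {u} → u < H i → toℕ i ≢ toℕ p
  occupied≢p i {u} u<H i≡p =
    n≮0 (subst (u <_) H[p]≡0 (subst (λ q → u < H q) (toℕ-injective i≡p) u<H))

  colouring : ℕColouring H D
  colouring = record
    { colour   = λ i → fromSide D (side i)
    ; colour-< = λ i u u<H → fromSide-< D (side i) (<-≤-trans u<H (H≤D i))
    ; parallel = λ i u u' u<H u'<H →
        fromSide-injective D (side i) (<-≤-trans u<H (H≤D i)) (<-≤-trans u'<H (H≤D i))
    ; adjacent = λ i u u' u<H u'<H → fromSide-apart (side i) (side (next i))
        (λ eq → parity-suc (pos i) (trans eq (cong parity (pos-next i (occupied≢p i u<H)))))
        u<H u'<H (H-bound i)
    }
    where
      H≤D : ∀ i → H i ≤ D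
      H≤D i = ≤-trans (m≤m+n (H i) _) (H-bound i)

excess-colourable : ∀ {n} (G : Multicycle (suc n)) {c} →
                    Colourable (C (suc n) (μ⁻ G)) c → Colourable G (c + (Δ G ∸ 2 * μ⁻ G))
excess-colourable G P with μ⁻-attained G
... | p , G[p]≡μ = fromℕColouring
  (superpose split (toℕColouring P) (PathColouring.colouring H p H[p]≡0 (Δ G ∸ 2 * μ) H-bound))
  where
    μ = μ⁻ G
    H : Multicycle _
    H i = G i ∸ μ
    split : ∀ i → G i ≡ μ + H i
    split i = sym (m+[n∸m]≡n (μ⁻-≤ G i))
    H[p]≡0 : H p ≡ 0
    H[p]≡0 = trans (cong (_∸ μ) G[p]≡μ) (n∸n≡0 μ)
    H-bound : ∀ i → H i + H (next i) ≤ Δ G ∸ 2 * μ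
    H-bound i = begin
      (G i ∸ μ) + (G (next i) ∸ μ) ≡⟨ +-∸-assoc (G i ∸ μ) (μ⁻-≤ G (next i)) ⟨
      (G i ∸ μ) + G (next i) ∸ μ   ≡⟨ cong (_∸ μ) (+-∸-comm (G (next i)) (μ⁻-≤ G i)) ⟨
      G i + G (next i) ∸ μ ∸ μ     ≡⟨ ∸-+-assoc (G i + G (next i)) μ μ ⟩
      G i + G (next i) ∸ (μ + μ)   ≤⟨ ∸-monoˡ-≤ (μ + μ) (Δ-≥ G i) ⟩
      Δ G ∸ (μ + μ)                ≡⟨ cong (Δ G ∸_) (cong (μ +_) (+-identityʳ μ)) ⟨
      Δ G ∸ 2 * μ                  ∎
      where open ≤-Reasoning

odd⇒≡1+2k : ∀ {m} → 3 ≤ m → m % 2 ≡ 1 → ∃ λ k' → m ≡ suc (suc k' * 2)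
odd⇒≡1+2k {m} 3≤m odd with m / 2 | trans (m≡m%n+[m/n]*n m 2) (cong (_+ m / 2 * 2) odd)
... | zero   | m≡1 = contradiction (subst (3 ≤_) m≡1 3≤m) λ { (s≤s ()) }
... | suc k' | m≡  = k' , m≡

corollary11 : (m : ℕ) → 3 ≤ m → m % 2 ≡ 1 →
              (G : Multicycle m) → (χG χC : ℕ) →
              IsChromaticIndex G χG →
              IsChromaticIndex (C m (μ⁻ G)) χC →
              (χG ≤ χC + Δ G ∸ 2 * μ⁻ G)
              × (χC + Δ G ∸ 2 * μ⁻ G ≡ Δ G + ⌈ μ⁻ G / ((m ∸ 1) / 2) ⌉)
corollary11 m 3≤m odd G χG χC (_ , χG-least) χC-is-χ' with odd⇒≡1+2k 3≤m odd
... | k' , refl = χG-bound , χC-formula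
  where
    μ = μ⁻ G
    t = ⌈ μ / suc k' ⌉
    χG-bound : χG ≤ χC + Δ G ∸ 2 * μ
    χG-bound = subst (χG ≤_) (sym (+-∸-assoc χC (2μ⁻≤Δ G)))
                     (χG-least _ (excess-colourable G (proj₁ χC-is-χ')))
    χC-formula : χC + Δ G ∸ 2 * μ ≡ Δ G + ⌈ μ / (suc k' * 2 / 2) ⌉
    χC-formula = begin
      χC + Δ G ∸ 2 * μ               ≡⟨ cong (λ χ → χ + Δ G ∸ 2 * μ) (χ'-C k' χC-is-χ') ⟩
      2 * μ + t + Δ G ∸ 2 * μ        ≡⟨ cong (_∸ 2 * μ) (+-assoc (2 * μ) t (Δ G)) ⟩
      2 * μ + (t + Δ G) ∸ 2 * μ      ≡⟨ m+n∸m≡n (2 * μ) (t + Δ G) ⟩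
      t + Δ G                        ≡⟨ +-comm t (Δ G) ⟩
      Δ G + t                        ≡⟨ cong (λ k → Δ G + ⌈ μ / k ⌉) (m*n/n≡m (suc k') 2) ⟨
      Δ G + ⌈ μ / (suc k' * 2 / 2) ⌉ ∎
      where open ≡-Reasoning
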